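{- Let $n\geq 3$ be an odd integer. Then: (1) there exists a perfect matching $F$ of $K_{2n}$ such that $\ell(F)=\{1^2,3^2,\ldots,(n-2)^2,n\}$; (2) there exists a perfect matching $F$ of $K_{2n}$ such that $\ell(F)=\{2^2,4^2,\ldots,(n-1)^2,n\}$.
   Context: For a positive integer $v$, $K_v$ denotes the complete graph on the vertex set $\{0,1,\ldots,v-1\}$. The length of an edge $\{u,w\}$ of $K_v$ is $\ell(u,w)=\min(|u-w|,\,v-|u-w|)$. For a subgraph $\Gamma$ of $K_v$, $\ell(\Gamma)$ is the list (multiset) of lengths of all edges of $\Gamma$, counted with multiplicity. A perfect matching of $K_{2n}$ is a set of $n$ pairwise disjoint edges covering all vertices. The notation $\{z_1^{e_1},\ldots,z_k^{e_k}\}$ denotes the list containing $e_i$ copies of $z_i$ (an element written without exponent appears once). -}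

module Defs where

open import Data.Nat using (ℕ; zero; suc; _+_; _*_; _∸_; _<_; _≤_)
open import Data.Nat.Base using (_⊓_)
open import Data.Product using (_×_; _,_; proj₁; proj₂)
open import Data.List using (List; []; _∷_; map; concatMap; upTo; _++_; [_])
open import Data.List.Relation.Unary.All using (All)
open import Data.List.Relation.Binary.Permutation.Propositional using (_↭_)
open import Relation.Binary.PropositionalEquality using (_≢_)

dist : ℕ → ℕ → ℕ
dist u w = (u ∸ w) + (w ∸ u)

edgeLength : ℕ → ℕ → ℕ → ℕ
edgeLength v u w = dist u w ⊓ (v ∸ dist u w)

-- an edge is an (unordered, represented by an ordered) pair of vertices
Edge : Set
Edge = ℕ × ℕ

IsEdgeOf : ℕ → Edge → Set
IsEdgeOf v (u , w) = (u < v) × (w < v) × (u ≢ w)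

endpoints : List Edge → List ℕ
endpoints = concatMap (λ e → proj₁ e ∷ proj₂ e ∷ [])

-- F is a perfect matching of K_v: a list of edges of K_v such that every
-- vertex 0,…,v-1 occurs as an endpoint of exactly one edge of F
-- (the multiset of all endpoints equals {0,…,v-1}).
IsPerfectMatching : ℕ → List Edge → Set
IsPerfectMatching v F = All (IsEdgeOf v) F × (endpoints F ↭ upTo v)

lengths : ℕ → List Edge → List ℕ
lengths v F = map (λ e → edgeLength v (proj₁ e) (proj₂ e)) F

oddTarget : ℕ → List ℕ
oddTarget k = concatMap (λ i → (2 * i + 1) ∷ (2 * i + 1) ∷ []) (upTo k) ++ [ 2 * k + 1 ]

evenTarget : ℕ → List ℕ
evenTarget k = concatMap (λ i → (2 * i + 2) ∷ (2 * i + 2) ∷ []) (upTo k) ++ [ 2 * k + 1 ]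

module Submission where

-- Write n = 2k + 1. Chords nested concentrically in [a, a + 2k + t) realise
-- the lengths 1 + t, 3 + t, …, 2k − 1 + t and miss only the t middle vertices,
-- so inside [a, a + n) exactly one vertex stays uncovered: a + 2k for t = 0,
-- a + k for t = 1. Two such blocks, at a = 0 and at a = n, together with the
-- diameter joining their uncovered vertices form a perfect matching of K_{2n}
-- in which every length below n occurs twice and n once. All chords have
-- length at most n, so their cyclic length is their plain length.

open import Defs
open import Data.Nat using (ℕ; zero; suc; _+_; _*_; _∸_; _<_; _≤_; _⊓_; z≤n; s≤s)
open import Data.Nat.Properties
open import Data.Product using (_×_; Σ; _,_)
open import Data.List using (List; []; _∷_; _++_; [_]; _∷ʳ_; map; concatMap; upTo; downFrom)
open import Data.List.Properties using (map-++; ++-assoc; ++-identityʳ; upTo-∷ʳ; reverse-upTo)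
open import Data.List.Relation.Unary.All using (All; []; _∷_)
import Data.List.Relation.Unary.All.Properties as All
open import Data.List.Relation.Binary.Permutation.Propositional
  using (_↭_; ↭-refl; ↭-sym; ↭-trans; ↭-prep; ↭-reflexive; module PermutationReasoning)
open import Data.List.Relation.Binary.Permutation.Propositional.Properties
  using (∷↭∷ʳ; shift; ++⁺ˡ; ++⁺ʳ; ++⁺; map⁺; ↭-reverse)
open import Relation.Binary.PropositionalEquality hiding ([_])

interval : ℕ → ℕ → List ℕ
interval a zero    = []
interval a (suc m) = a ∷ interval (suc a) m

interval-∷ʳ : ∀ a m → interval a m ∷ʳ (a + m) ≡ interval a (suc m)
interval-∷ʳ a zero    = cong [_] (+-identityʳ a)
interval-∷ʳ a (suc m) =
  cong (a ∷_) (trans (cong (interval (suc a) m ∷ʳ_) (+-suc a m)) (interval-∷ʳ (suc a) m))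

interval-++ : ∀ a m n → interval a m ++ interval (a + m) n ≡ interval a (m + n)
interval-++ a zero    n = cong (λ b → interval b n) (+-identityʳ a)
interval-++ a (suc m) n =
  cong (a ∷_) (trans (cong (λ b → interval (suc a) m ++ interval b n) (+-suc a m)) (interval-++ (suc a) m n))

upTo≡interval : ∀ n → upTo n ≡ interval 0 n
upTo≡interval zero    = refl
upTo≡interval (suc n) = begin
  upTo (suc n)        ≡⟨ upTo-∷ʳ n ⟨
  upTo n ∷ʳ n         ≡⟨ cong (_∷ʳ n) (upTo≡interval n) ⟩
  interval 0 n ∷ʳ n   ≡⟨ interval-∷ʳ 0 n ⟩
  interval 0 (suc n)  ∎
  where open ≡-Reasoning

upTo↭downFrom : ∀ n → upTo n ↭ downFrom n
upTo↭downFrom n = ↭-trans (↭-sym (↭-reverse (upTo n))) (↭-reflexive (reverse-upTo n))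

concatMap-twice↭ : ∀ {A B : Set} (f : A → B) xs → concatMap (λ x → f x ∷ f x ∷ []) xs ↭ map f xs ++ map f xs
concatMap-twice↭ f []       = ↭-refl
concatMap-twice↭ f (x ∷ xs) =
  ↭-prep (f x) (↭-trans (↭-prep (f x) (concatMap-twice↭ f xs)) (↭-sym (shift (f x) (map f xs) (map f xs))))

endpoints-++ : ∀ xs ys → endpoints (xs ++ ys) ≡ endpoints xs ++ endpoints ys
endpoints-++ []             ys = refl
endpoints-++ ((u , w) ∷ xs) ys = cong (λ zs → u ∷ w ∷ zs) (endpoints-++ xs ys)

dist-+ʳ : ∀ a m → dist a (a + m) ≡ m
dist-+ʳ a m = cong₂ _+_ (m≤n⇒m∸n≡0 (m≤m+n a m)) (m+n∸m≡n a m)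

edgeLength-+ʳ : ∀ {n} a {m} → m ≤ n → edgeLength (2 * n) a (a + m) ≡ m
edgeLength-+ʳ {n} a {m} m≤n =
  trans (cong (λ d → d ⊓ (2 * n ∸ d)) (dist-+ʳ a m)) (m≤n⇒m⊓n≡m m≤2n∸m)
  where
  m≤2n∸m : m ≤ 2 * n ∸ m
  m≤2n∸m = begin
    m                  ≤⟨ m≤n ⟩
    n                  ≤⟨ m≤m+n n _ ⟩
    n + (n + 0 ∸ m)    ≡⟨ +-∸-assoc n (≤-trans m≤n (m≤m+n n 0)) ⟨
    2 * n ∸ m          ∎
    where open ≤-Reasoning

isEdgeOf-+ʳ : ∀ {v} a {m} → 0 < m → a + m < v → IsEdgeOf v (a , a + m)
isEdgeOf-+ʳ a 0<m a+m<v = <-trans (m<m+n a 0<m) a+m<v , a+m<v , <⇒≢ (m<m+n a 0<m)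

-- nested a t k: the chords (a + i, a + 2k + t − 1 − i) for i < k.
nested : ℕ → ℕ → ℕ → List Edge
nested a t zero    = []
nested a t (suc k) = (a , a + (2 * k + suc t)) ∷ nested (suc a) t k

2*suc-+ : ∀ k t → 2 * suc k + t ≡ suc (suc (2 * k + t))
2*suc-+ k t = cong (_+ t) (*-suc 2 k)

endpoints-nested : ∀ a t k → endpoints (nested a t k) ++ interval (a + k) t ↭ interval a (2 * k + t)
endpoints-nested a t zero    = ↭-reflexive (cong (λ b → interval b t) (+-identityʳ a))
endpoints-nested a t (suc k) = begin
  a ∷ b ∷ (endpoints (nested (suc a) t k) ++ interval (a + suc k) t)
    ≡⟨ cong (λ c → a ∷ b ∷ endpoints (nested (suc a) t k) ++ interval c t) (+-suc a k) ⟩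
  a ∷ b ∷ (endpoints (nested (suc a) t k) ++ interval (suc a + k) t)
    ↭⟨ ↭-prep a (↭-prep b (endpoints-nested (suc a) t k)) ⟩
  a ∷ b ∷ interval (suc a) m
    ↭⟨ ↭-prep a (∷↭∷ʳ b (interval (suc a) m)) ⟩
  a ∷ (interval (suc a) m ∷ʳ b)
    ≡⟨ cong (λ c → a ∷ interval (suc a) m ∷ʳ c) (trans (cong (a +_) (+-suc (2 * k) t)) (+-suc a m)) ⟩
  a ∷ (interval (suc a) m ∷ʳ (suc a + m))
    ≡⟨ cong (a ∷_) (interval-∷ʳ (suc a) m) ⟩
  interval a (suc (suc m))
    ≡⟨ cong (interval a) (2*suc-+ k t) ⟨
  interval a (2 * suc k + t) ∎
  where
  open PermutationReasoning
  m = 2 * k + t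
  b = a + (2 * k + suc t)

endpoints-nested₀ : ∀ a k → endpoints (nested a 0 k) ↭ interval a (2 * k)
endpoints-nested₀ a k = begin
  endpoints (nested a 0 k)       ≡⟨ ++-identityʳ _ ⟨
  endpoints (nested a 0 k) ++ [] ↭⟨ endpoints-nested a 0 k ⟩
  interval a (2 * k + 0)         ≡⟨ cong (interval a) (+-identityʳ (2 * k)) ⟩
  interval a (2 * k)             ∎
  where open PermutationReasoning

nested-isEdgeOf : ∀ {v} a t k → a + (2 * k + t) ≤ v → All (IsEdgeOf v) (nested a t k)
nested-isEdgeOf a t zero    _ = []
nested-isEdgeOf {v} a t (suc k) a+2k+2+t≤v =
  isEdgeOf-+ʳ a (subst (0 <_) (sym (+-suc (2 * k) t)) (s≤s z≤n)) (subst (_< v) (sym outer) a+m+1<v)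
    ∷ nested-isEdgeOf (suc a) t k (<⇒≤ a+m+1<v)
  where
  m = 2 * k + t
  outer : a + (2 * k + suc t) ≡ suc (a + m)
  outer = trans (cong (a +_) (+-suc (2 * k) t)) (+-suc a m)
  a+m+1<v : suc (a + m) < v
  a+m+1<v = subst (_≤ v) (trans (cong (a +_) (2*suc-+ k t)) (trans (+-suc a _) (cong suc (+-suc a m)))) a+2k+2+t≤v

lengths-nested : ∀ {n} a t k → 2 * k + t ≤ n → lengths (2 * n) (nested a t k) ≡ map (λ i → 2 * i + suc t) (downFrom k)
lengths-nested a t zero    _ = refl
lengths-nested {n} a t (suc k) 2k+2+t≤n =
  cong₂ _∷_ (edgeLength-+ʳ a (subst (_≤ n) (sym (+-suc (2 * k) t)) (<⇒≤ m+1<n)))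
            (lengths-nested (suc a) t k (<⇒≤ (<⇒≤ m+1<n)))
  where
  m+1<n : suc (2 * k + t) < n
  m+1<n = subst (_≤ n) (2*suc-+ k t) 2k+2+t≤n

-- Intended for blocks B a matching [a, a + n) except a + c; (c, c + n) is a diameter of K_{2n}.
joinCopies : ℕ → ℕ → (ℕ → List Edge) → List Edge
joinCopies n c B = B 0 ++ (c , c + n) ∷ B n

joinCopies-isPerfectMatching : ∀ {n c} (B : ℕ → List Edge) → c < n →
  (∀ a → endpoints (B a) ++ [ a + c ] ↭ interval a n) →
  All (IsEdgeOf (2 * n)) (B 0) → All (IsEdgeOf (2 * n)) (B n) →
  IsPerfectMatching (2 * n) (joinCopies n c B)
joinCopies-isPerfectMatching {n} {c} B c<n B-endpoints B₀-edges Bₙ-edges =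
  All.++⁺ B₀-edges (isEdgeOf-+ʳ c (≤-trans (s≤s z≤n) c<n) c+n<2n ∷ Bₙ-edges) , endpoints↭
  where
  n+n≡2n : n + n ≡ 2 * n
  n+n≡2n = cong (n +_) (sym (+-identityʳ n))
  c+n<2n : c + n < 2 * n
  c+n<2n = subst (c + n <_) n+n≡2n (+-monoˡ-< n c<n)
  E₀ = endpoints (B 0)
  Eₙ = endpoints (B n)
  endpoints↭ : endpoints (joinCopies n c B) ↭ upTo (2 * n)
  endpoints↭ = begin
    endpoints (B 0 ++ (c , c + n) ∷ B n) ≡⟨ endpoints-++ (B 0) _ ⟩
    E₀ ++ c ∷ c + n ∷ Eₙ                 ≡⟨ ++-assoc E₀ [ c ] _ ⟨
    (E₀ ++ [ c ]) ++ c + n ∷ Eₙ          ↭⟨ ++⁺ˡ (E₀ ++ [ c ]) (∷↭∷ʳ (c + n) Eₙ) ⟩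
    (E₀ ++ [ c ]) ++ Eₙ ∷ʳ (c + n)       ≡⟨ cong (λ x → (E₀ ++ [ c ]) ++ Eₙ ∷ʳ x) (+-comm c n) ⟩
    (E₀ ++ [ c ]) ++ Eₙ ∷ʳ (n + c)       ↭⟨ ++⁺ (B-endpoints 0) (B-endpoints n) ⟩
    interval 0 n ++ interval n n         ≡⟨ interval-++ 0 n n ⟩
    interval 0 (n + n)                   ≡⟨ cong (interval 0) n+n≡2n ⟩
    interval 0 (2 * n)                   ≡⟨ upTo≡interval (2 * n) ⟨
    upTo (2 * n)                         ∎
    where open PermutationReasoning

lengths-joinCopies : ∀ {n c} (B : ℕ → List Edge) →
  lengths (2 * n) (joinCopies n c B) ≡ lengths (2 * n) (B 0) ++ n ∷ lengths (2 * n) (B n)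
lengths-joinCopies {n} {c} B =
  trans (map-++ _ (B 0) _) (cong (λ x → lengths (2 * n) (B 0) ++ x ∷ lengths (2 * n) (B n)) (edgeLength-+ʳ c ≤-refl))

twice-upTo↭ : ∀ (f : ℕ → ℕ) k x →
  concatMap (λ i → f i ∷ f i ∷ []) (upTo k) ++ [ x ] ↭ map f (downFrom k) ++ x ∷ map f (downFrom k)
twice-upTo↭ f k x = begin
  concatMap (λ i → f i ∷ f i ∷ []) (upTo k) ++ [ x ] ↭⟨ ++⁺ʳ [ x ] (concatMap-twice↭ f (upTo k)) ⟩
  (map f (upTo k) ++ map f (upTo k)) ++ [ x ]        ↭⟨ ++⁺ʳ [ x ] (++⁺ L↭ L↭) ⟩
  (L ++ L) ++ [ x ]                                   ≡⟨ ++-assoc L L [ x ] ⟩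
  L ++ L ∷ʳ x                                         ↭⟨ ++⁺ˡ L (∷↭∷ʳ x L) ⟨
  L ++ x ∷ L                                          ∎
  where
  open PermutationReasoning
  L = map f (downFrom k)
  L↭ : map f (upTo k) ↭ L
  L↭ = map⁺ f (upTo↭downFrom k)

lengths-joinNested : ∀ {n} c t k → 2 * k + t ≤ n →
  lengths (2 * n) (joinCopies n c (λ a → nested a t k))
    ↭ concatMap (λ i → (2 * i + suc t) ∷ (2 * i + suc t) ∷ []) (upTo k) ++ [ n ]
lengths-joinNested {n} c t k 2k+t≤n = begin
  lengths (2 * n) (joinCopies n c (λ a → nested a t k))
    ≡⟨ lengths-joinCopies (λ a → nested a t k) ⟩
  lengths (2 * n) (nested 0 t k) ++ n ∷ lengths (2 * n) (nested n t k)
    ≡⟨ cong₂ (λ xs ys → xs ++ n ∷ ys) (lengths-nested 0 t k 2k+t≤n) (lengths-nested n t k 2k+t≤n) ⟩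
  map f (downFrom k) ++ n ∷ map f (downFrom k)
    ↭⟨ twice-upTo↭ f k n ⟨
  concatMap (λ i → f i ∷ f i ∷ []) (upTo k) ++ [ n ] ∎
  where
  open PermutationReasoning
  f = λ i → 2 * i + suc t

joinNested-isPerfectMatching : ∀ {n} c t k → c < n → 2 * k + t ≤ n →
  (∀ a → endpoints (nested a t k) ++ [ a + c ] ↭ interval a n) →
  IsPerfectMatching (2 * n) (joinCopies n c (λ a → nested a t k))
joinNested-isPerfectMatching {n} c t k c<n 2k+t≤n endpoints↭ =
  joinCopies-isPerfectMatching (λ a → nested a t k) c<n endpoints↭
    (nested-isEdgeOf 0 t k (≤-trans 2k+t≤n (m≤m+n n _)))
    (nested-isEdgeOf n t k (subst (n + (2 * k + t) ≤_) (cong (n +_) (sym (+-identityʳ n))) (+-monoʳ-≤ n 2k+t≤n)))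

proposition4p11 : (k : ℕ) → 1 ≤ k →
    (Σ (List Edge) (λ F → IsPerfectMatching (2 * (2 * k + 1)) F
        × (lengths (2 * (2 * k + 1)) F ↭ oddTarget k)))
    × (Σ (List Edge) (λ F → IsPerfectMatching (2 * (2 * k + 1)) F
        × (lengths (2 * (2 * k + 1)) F ↭ evenTarget k)))
proposition4p11 k _ =
  ( joinCopies n (2 * k) (λ a → nested a 0 k)
  , joinNested-isPerfectMatching (2 * k) 0 k (m<m+n (2 * k) (s≤s z≤n)) (+-monoʳ-≤ (2 * k) z≤n) odd-endpoints
  , lengths-joinNested {n} (2 * k) 0 k (+-monoʳ-≤ (2 * k) z≤n) )
  , ( joinCopies n k (λ a → nested a 1 k)
  , joinNested-isPerfectMatching k 1 k (≤-<-trans (m≤m+n k _) (m<m+n (2 * k) (s≤s z≤n))) ≤-refl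
      (λ a → endpoints-nested a 1 k)
  , lengths-joinNested {n} k 1 k ≤-refl )
  where
  n = 2 * k + 1
  odd-endpoints : ∀ a → endpoints (nested a 0 k) ++ [ a + 2 * k ] ↭ interval a n
  odd-endpoints a = ↭-trans (++⁺ʳ [ a + 2 * k ] (endpoints-nested₀ a k))
    (↭-reflexive (trans (interval-∷ʳ a (2 * k)) (cong (interval a) (+-comm 1 (2 * k)))))
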